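{- For every unsatisfiable clause-set $F$ and every $k\in\mathbb{N}_0$: $\mathrm{whd}(F)>k$ if and only if there exists a $k$-consistent set of partial assignments for $F$.
   Context: Literals are variables $v$ or negations $\overline{v}$; clauses are finite sets of literals without complementary pair; clause-sets are finite sets of clauses; $\bot$ is the empty clause; $\mathrm{var}(F)$ is the set of variables of $F$. A partial assignment $\varphi$ maps a finite variable set $\mathrm{var}(\varphi)$ to $\{0,1\}$, $n(\varphi)=|\mathrm{var}(\varphi)|$, $\langle v\to\varepsilon\rangle$ is the assignment setting only $v$ to $\varepsilon$; $\varphi*F$ removes satisfied clauses and false literals. $F$ is unsatisfiable if no $\varphi$ yields $\varphi*F=\emptyset$. Resolution: clauses $C,D$ with exactly one clashing literal $x\in C$, $\overline{x}\in D$ have resolvent $(C\cup D)\setminus\{x,\overline{x}\}$. A resolution tree is a finite rooted tree, each inner node having exactly two children, nodes labelled by clauses, each inner label the resolvent of its children's labels; a refutation of $F$ has leaf labels in $F$ and root label $\bot$. Asymmetric width of a resolution tree $T$: $\mathrm{whd}(T)=0$ if $T$ is a single node; otherwise, with children $w_1,w_2$ of the root labelled $C_1,C_2$ and subtrees $T_1,T_2$, $\mathrm{whd}(T)=\max(\mathrm{whd}(T_1),\mathrm{whd}(T_2),\min(|C_1|,|C_2|))$. For unsatisfiable $F$, $\mathrm{whd}(F)$ is the minimum of $\mathrm{whd}(T)$ over refutations $T$ of $F$. A set $\mathbb{P}$ of partial assignments is minimally consistent for $F$ if $\mathbb{P}\neq\emptyset$, every $\varphi\in\mathbb{P}$ has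 $\mathrm{var}(\varphi)\subseteq\mathrm{var}(F)$, and $\bot\notin\varphi*F$ for every $\varphi\in\mathbb{P}$. It is $k$-consistent for $F$ if it is minimally consistent and for all $\varphi\in\mathbb{P}$, all $v\in\mathrm{var}(F)\setminus\mathrm{var}(\varphi)$, all $\psi\subseteq\varphi$ with $n(\psi)<k$ and both $\varepsilon\in\{0,1\}$ there is $\varphi'\in\mathbb{P}$ with $\psi\cup\langle v\to\varepsilon\rangle\subseteq\varphi'$. -}

module Defs where

open import Data.Nat using (ℕ; zero; suc; _<_; _⊔_; _⊓_)
open import Data.Bool using (Bool; true; false; not)
open import Data.Product using (Σ; ∃; _×_; _,_; proj₁; proj₂)
open import Data.Sum using (_⊎_)
open import Data.List using (List; []; _∷_; map; length)
open import Data.List.Membership.Propositional using (_∈_; _∉_)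
open import Data.List.Relation.Unary.All using (All)
open import Data.List.Relation.Unary.Unique.Propositional using (Unique)
open import Relation.Binary.PropositionalEquality using (_≡_; _≢_)
open import Relation.Nullary using (¬_)
open import Level using (Level) renaming (suc to lsuc; zero to lzero)

-- Variables are natural numbers. A literal is a variable with a sign
-- (pos = true : the variable v, pos = false : its negation v̄).
record Lit : Set where
  constructor lit
  field
    var : ℕ
    pos : Bool
open Lit public

‾_ : Lit → Lit
‾ (lit v s) = lit v (not s)

-- A clause is represented by a duplicate-free list of literals (so that
-- its length is its cardinality) without a complementary pair.
Clause : Set
Clause = List Lit

IsClause : Clause → Set
IsClause C = Unique C × (∀ x → x ∈ C → ‾ x ∉ C)

_≐_ : Clause → Clause → Set
C ≐ D = ∀ x → (x ∈ C → x ∈ D) × (x ∈ D → x ∈ C)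

∣_∣ : Clause → ℕ
∣ C ∣ = length C

ClauseSet : Set
ClauseSet = List Clause

IsClauseSet : ClauseSet → Set
IsClauseSet F = All IsClause F

_∈var_ : ℕ → ClauseSet → Set
v ∈var F = ∃ λ C → C ∈ F × ∃ λ x → x ∈ C × var x ≡ v

-- A partial assignment is a list of pairs (v , ε), meaning v ↦ ε,
-- with no variable occurring twice.
PAss : Set
PAss = List (ℕ × Bool)

IsPAss : PAss → Set
IsPAss φ = Unique (map proj₁ φ)

varsP : PAss → List ℕ
varsP φ = map proj₁ φ

n : PAss → ℕ
n φ = length φ

_⊆ₚ_ : PAss → PAss → Set
ψ ⊆ₚ φ = ∀ p → p ∈ ψ → p ∈ φ

TrueUnder : PAss → Lit → Set
TrueUnder φ x = (var x , pos x) ∈ φ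

FalseUnder : PAss → Lit → Set
FalseUnder φ x = (var x , not (pos x)) ∈ φ

-- ⊥ ∈ φ * F : some clause of F has all its literals set false by φ
-- (it is not satisfied and all its literals are removed).
⊥∈_*_ : PAss → ClauseSet → Set
⊥∈ φ * F = ∃ λ C → C ∈ F × All (FalseUnder φ) C

-- φ * F = ∅ : every clause of F is satisfied by φ
Satisfies : PAss → ClauseSet → Set
Satisfies φ F = All (λ C → ∃ λ x → x ∈ C × TrueUnder φ x) F

Unsatisfiable : ClauseSet → Set
Unsatisfiable F = ¬ (∃ λ φ → IsPAss φ × Satisfies φ F)

ResolventOn : Clause → Clause → Lit → Clause → Set
ResolventOn C D x R =
  x ∈ C × ‾ x ∈ D ×
  (∀ y → y ∈ C → ‾ y ∈ D → y ≡ x) ×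
  (∀ y → (y ∈ R → (y ∈ C ⊎ y ∈ D) × y ≢ x × y ≢ ‾ x) ×
         ((y ∈ C ⊎ y ∈ D) → y ≢ x → y ≢ ‾ x → y ∈ R))

Resolvent : Clause → Clause → Clause → Set
Resolvent C D R = ∃ λ x → ResolventOn C D x R

data Tree : Set where
  leaf : Clause → Tree
  node : Clause → Tree → Tree → Tree

label : Tree → Clause
label (leaf C) = C
label (node C _ _) = C

-- all labels are clauses, each inner label is the resolvent of
-- its children's labels (the two children are unordered)
data IsResTree : Tree → Set where
  leaf : ∀ {C} → IsClause C → IsResTree (leaf C)
  node : ∀ {C T₁ T₂} → IsClause C →
         (Resolvent (label T₁) (label T₂) C ⊎ Resolvent (label T₂) (label T₁) C) →
         IsResTree T₁ → IsResTree T₂ → IsResTree (node C T₁ T₂)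

LeavesIn : ClauseSet → Tree → Set
LeavesIn F (leaf C) = ∃ λ D → D ∈ F × C ≐ D
LeavesIn F (node _ T₁ T₂) = LeavesIn F T₁ × LeavesIn F T₂

IsRefutation : ClauseSet → Tree → Set
IsRefutation F T = IsResTree T × LeavesIn F T × label T ≡ []

whd : Tree → ℕ
whd (leaf _) = 0
whd (node _ T₁ T₂) = (whd T₁ ⊔ whd T₂) ⊔ (∣ label T₁ ∣ ⊓ ∣ label T₂ ∣)

-- whd(F) > k, i.e. min over refutations T of whd(T) is > k,
-- i.e. every refutation T of F has whd(T) > k
WhdGreater : ClauseSet → ℕ → Set
WhdGreater F k = ∀ T → IsRefutation F T → k < whd T

MinimallyConsistent : ClauseSet → (PAss → Set) → Set
MinimallyConsistent F ℙ =
  (∃ λ φ → ℙ φ) ×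
  (∀ φ → ℙ φ → IsPAss φ × (∀ v → v ∈ varsP φ → v ∈var F) × ¬ (⊥∈ φ * F))

KConsistent : ℕ → ClauseSet → (PAss → Set) → Set
KConsistent k F ℙ =
  MinimallyConsistent F ℙ ×
  (∀ φ → ℙ φ → ∀ v → v ∈var F → v ∉ varsP φ →
   ∀ ψ → IsPAss ψ → ψ ⊆ₚ φ → n ψ < k → ∀ (ε : Bool) →
   ∃ λ φ′ → ℙ φ′ × ψ ⊆ₚ φ′ × (v , ε) ∈ φ′)

-- If φ ∈ ℙ falsified the resolvent of C ∋ x and D ∋ x̄ with |C| ≤ k, then either φ
-- assigns var(x) and so falsifies C or D, or k-consistency extends the (< k)
-- assignments of φ falsifying C − {x} by x ↦ 0, falsifying C. Hence along a
-- refutation of asymmetric width ≤ k no member of ℙ falsifies any clause, yet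
-- every assignment falsifies ⊥.
--
-- Conversely, suppose ⊥ has no such refutation. Call φ stable if it falsifies no
-- clause derivable in asymmetric width ≤ k and is closed under unit propagation
-- along derivable clauses of length ≤ k. For stable φ, ψ ⊆ φ with |ψ| < k and v
-- unassigned, propagation from ψ ∪ {v ↦ ε} never reaches a conflict: conflict
-- analysis would give a derivable clause falsified by ψ ∪ {v ↦ ε}, which is either
-- falsified by φ or, having at most |ψ| + 1 ≤ k literals, forces v under φ. So the
-- stable assignments form a k-consistent set. Propagation to a fixpoint is only
-- available under double negation here, so the set actually used is the greatest
-- subset of the finitely many assignments over var(F) satisfying the (decidable)
-- k-consistency condition; it contains the normal forms of all stable assignments.

module Submission where

open import Defs
open import Data.Bool using (Bool; true; false; not)
import Data.Bool.Properties as Bool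
open import Data.Nat using (ℕ; zero; suc; _+_; _≤_; _<_; _⊔_; z≤n; s≤s)
import Data.Nat.Properties as ℕ
open import Data.Product using (∃; _×_; _,_; proj₁; proj₂)
open import Data.Product.Properties using (≡-dec)
open import Data.Sum using (_⊎_; inj₁; inj₂)
import Data.Sum as Sum
open import Data.List using (List; []; _∷_; map; length; filter; _++_; concat; deduplicate; cartesianProduct)
open import Data.List.Properties using (length-map; length-++; filter-notAll)
open import Data.List.Membership.Propositional using (_∈_; _∉_; find; lose)
open import Data.List.Membership.Propositional.Properties
  using (∈-map⁺; ∈-map⁻; ∈-filter⁺; ∈-filter⁻; ∈-++⁺ˡ; ∈-++⁺ʳ; ∈-++⁻; ∈-∃++;
         ∈-concat⁺′; ∈-concat⁻′; ∈-deduplicate⁺; ∈-deduplicate⁻;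
         ∈-cartesianProduct⁺; ∈-cartesianProduct⁻)
open import Data.List.Relation.Binary.Subset.Propositional using (_⊆_)
import Data.List.Relation.Binary.Subset.Propositional.Properties as Subset
open import Data.List.Relation.Unary.All as All using (All; []; _∷_)
import Data.List.Relation.Unary.All.Properties as All
open import Data.List.Relation.Unary.Any as Any using (Any; here; there)
open import Data.List.Relation.Unary.Unique.Propositional using (Unique; []; _∷_)
import Data.List.Relation.Unary.Unique.Propositional.Properties as Unique
open import Data.List.Relation.Unary.Unique.DecPropositional.Properties using (deduplicate-!)
open import Data.List.Relation.Unary.Unique.DecPropositional ℕ._≟_ using (unique?)
open import Relation.Binary.Definitions using (DecidableEquality)
open import Relation.Binary.PropositionalEquality
  using (_≡_; _≢_; refl; sym; trans; cong; subst)
open import Relation.Nullary using (¬_; Dec; yes; no)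
import Relation.Unary as U
open import Relation.Nullary.Decidable using (¬?; _×-dec_; _→-dec_; decidable-stable)
open import Data.Empty using (⊥; ⊥-elim)
open import Function using (_∘_; id)

private variable
  A : Set
  x y z w : Lit
  C D E R : Clause
  φ σ : PAss
  F : ClauseSet
  k : ℕ

Unique-⊆⇒length-≤ : {xs ys : List A} → Unique xs → xs ⊆ ys → length xs ≤ length ys
Unique-⊆⇒length-≤ {xs = []} _ _ = z≤n
Unique-⊆⇒length-≤ {xs = x ∷ xs} {ys} (x∉xs ∷ uxs) xs⊆ys
  with as , bs , refl ← ∈-∃++ (xs⊆ys (here refl)) =
  subst (length (x ∷ xs) ≤_) (sym length-split) (s≤s (Unique-⊆⇒length-≤ uxs xs⊆as++bs))
  where
  xs⊆as++bs : xs ⊆ as ++ bs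
  xs⊆as++bs {y} y∈xs with ∈-++⁻ as (xs⊆ys (there y∈xs))
  ... | inj₁ y∈as = ∈-++⁺ˡ y∈as
  ... | inj₂ (here refl) = ⊥-elim (All.lookup x∉xs y∈xs refl)
  ... | inj₂ (there y∈bs) = ∈-++⁺ʳ as y∈bs
  length-split : length (as ++ x ∷ bs) ≡ suc (length (as ++ bs))
  length-split = trans (length-++ as) (trans (ℕ.+-suc (length as) (length bs))
                                             (cong suc (sym (length-++ as))))

List-inhabited : (xs : List A) → ¬ ¬ (∃ λ x → x ∈ xs) → ∃ λ x → x ∈ xs
List-inhabited []      inhabited = ⊥-elim (inhabited λ ())
List-inhabited (x ∷ _) _         = x , here refl

sublists : List A → List (List A)
sublists []       = [] ∷ []
sublists (x ∷ xs) = map (x ∷_) (sublists xs) ++ sublists xs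

filter∈sublists : ∀ {P : A → Set} (P? : U.Decidable P) xs → filter P? xs ∈ sublists xs
filter∈sublists P? [] = here refl
filter∈sublists P? (x ∷ xs) with P? x
... | yes _ = ∈-++⁺ˡ (∈-map⁺ (x ∷_) (filter∈sublists P? xs))
... | no _  = ∈-++⁺ʳ (map (x ∷_) (sublists xs)) (filter∈sublists P? xs)

sublists-⊆ : ∀ {s} (xs : List A) → s ∈ sublists xs → s ⊆ xs
sublists-⊆ [] (here refl) ()
sublists-⊆ (x ∷ xs) s∈ with ∈-++⁻ (map (x ∷_) (sublists xs)) s∈
... | inj₂ s∈′ = there ∘ sublists-⊆ xs s∈′
... | inj₁ s∈′ with s′ , s′∈ , refl ← ∈-map⁻ (x ∷_) s∈′ = λ
  { (here refl) → here refl
  ; (there y∈s′) → there (sublists-⊆ xs s′∈ y∈s′) }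

module _ {Ok : List A → A → Set} (Ok? : ∀ S u → Dec (Ok S u)) {Keep : A → Set}
         (Keep⇒Ok : ∀ {S} → (∀ {u} → Keep u → u ∈ S) → ∀ {u} → Keep u → Ok S u) where

  prune : ∀ m S → length S ≤ m → (∀ {u} → Keep u → u ∈ S) →
          ∃ λ G → G ⊆ S × All (Ok G) G × (∀ {u} → Keep u → u ∈ G)
  prune zero [] _ S⊇Keep = [] , id , [] , S⊇Keep
  prune (suc m) S |S|≤1+m S⊇Keep with All.all? (Ok? S) S
  ... | yes all-ok = S , id , all-ok , S⊇Keep
  ... | no not-all-ok =
    let G , G⊆S′ , G-ok , G⊇Keep = prune m S′ |S′|≤m S′⊇Keep
    in G , proj₁ ∘ ∈-filter⁻ (Ok? S) ∘ G⊆S′ , G-ok , G⊇Keep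
    where
    S′ = filter (Ok? S) S
    |S′|≤m : length S′ ≤ m
    |S′|≤m = ℕ.≤-pred (ℕ.≤-trans (filter-notAll (Ok? S) S (All.¬All⇒Any¬ (Ok? S) S not-all-ok)) |S|≤1+m)
    S′⊇Keep : ∀ {u} → Keep u → u ∈ S′
    S′⊇Keep Keep-u = ∈-filter⁺ (Ok? S) (S⊇Keep Keep-u) (Keep⇒Ok S⊇Keep Keep-u)

infix 4 _≟ˡ_
_≟ˡ_ : DecidableEquality Lit
lit a s ≟ˡ lit b t with a ℕ.≟ b | s Bool.≟ t
... | yes refl | yes refl = yes refl
... | no a≢b   | _        = no λ { refl → a≢b refl }
... | yes _    | no s≢t   = no λ { refl → s≢t refl }

open import Data.List.Membership.DecPropositional _≟ˡ_ using () renaming (_∈?_ to _∈ˡ?_)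
open import Data.List.Membership.DecPropositional ℕ._≟_ using () renaming (_∈?_ to _∈ⁿ?_)
open import Data.List.Membership.DecPropositional (≡-dec ℕ._≟_ Bool._≟_) using () renaming (_∈?_ to _∈ᵖ?_)

‾-involutive : ∀ x → ‾ (‾ x) ≡ x
‾-involutive (lit a s) = cong (lit a) (Bool.not-involutive s)

All-except : ∀ {P : Lit → Set} → (∀ {y} → y ∈ C → y ≢ x → P y) → P x → All P C
All-except {C = C} {x = x} {P = P} P-rest Px = All.tabulate P-at
  where
  P-at : ∀ {y} → y ∈ C → P y
  P-at {y} y∈C with y ≟ˡ x
  ... | yes refl = Px
  ... | no y≢x   = P-rest y∈C y≢x

falsifiedBy : ℕ × Bool → Lit
falsifiedBy (v , ε) = lit v (not ε)

falsifiedBy-injective : ∀ {p q} → falsifiedBy p ≡ falsifiedBy q → p ≡ q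
falsifiedBy-injective e with refl ← cong var e | refl ← Bool.not-injective (cong pos e) = refl

falsifiedBy-FalseUnder : ∀ y → falsifiedBy (var y , not (pos y)) ≡ y
falsifiedBy-FalseUnder (lit a s) = cong (lit a) (Bool.not-involutive s)

FalseUnder-∷⁻ : ∀ {p} → FalseUnder (p ∷ φ) y → y ≡ falsifiedBy p ⊎ FalseUnder φ y
FalseUnder-∷⁻ {y = y} (here refl) = inj₁ (sym (falsifiedBy-FalseUnder y))
FalseUnder-∷⁻ (there y↦0) = inj₂ y↦0

FalseUnder⇒∈falsified : FalseUnder φ y → y ∈ map falsifiedBy φ
FalseUnder⇒∈falsified {y = y} y↦0 =
  subst (_∈ _) (falsifiedBy-FalseUnder y) (∈-map⁺ falsifiedBy y↦0)

assigned⇒FalseUnder : var x ∈ varsP φ → FalseUnder φ x ⊎ FalseUnder φ (‾ x)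
assigned⇒FalseUnder {x = lit a s} a∈φ with ∈-map⁻ proj₁ a∈φ
... | (.a , b) , a↦b , refl with s | b
... | false | true  = inj₁ a↦b
... | false | false = inj₂ a↦b
... | true  | false = inj₁ a↦b
... | true  | true  = inj₂ a↦b

Functional : PAss → Set
Functional φ = ∀ {v ε ε′} → (v , ε) ∈ φ → (v , ε′) ∈ φ → ε ≡ ε′

IsPAss⇒Functional : IsPAss φ → Functional φ
IsPAss⇒Functional (_ ∷ _) (here refl) (here refl) = refl
IsPAss⇒Functional (v∉φ ∷ _) (here refl) (there v↦ε′) = ⊥-elim (All.lookup v∉φ (∈-map⁺ proj₁ v↦ε′) refl)
IsPAss⇒Functional (v∉φ ∷ _) (there v↦ε) (here refl) = ⊥-elim (All.lookup v∉φ (∈-map⁺ proj₁ v↦ε) refl)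
IsPAss⇒Functional (_ ∷ uφ) (there v↦ε) (there v↦ε′) = IsPAss⇒Functional uφ v↦ε v↦ε′

Unique⇒IsPAss : ∀ {ψ} → Unique ψ → ψ ⊆ φ → IsPAss φ → IsPAss ψ
Unique⇒IsPAss [] _ _ = []
Unique⇒IsPAss {ψ = (v , ε) ∷ ψ} (p∉ψ ∷ uψ) ψ⊆φ φ-pass =
  All.map⁺ (All.tabulate new-key) ∷ Unique⇒IsPAss uψ (ψ⊆φ ∘ there) φ-pass
  where
  new-key : ∀ {q} → q ∈ ψ → v ≢ proj₁ q
  new-key {.v , ε′} q∈ψ refl
    with refl ← IsPAss⇒Functional φ-pass (ψ⊆φ (here refl)) (ψ⊆φ (there q∈ψ))
    = All.lookup p∉ψ q∈ψ refl

IsPAss⇒Unique : IsPAss φ → Unique φ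
IsPAss⇒Unique = Unique.map⁻

FalseUnder-complement : Functional φ → FalseUnder φ x → ¬ FalseUnder φ (‾ x)
FalseUnder-complement φ-fun x↦0 ‾x↦0 = Bool.not-¬ refl (φ-fun x↦0 ‾x↦0)

falsified-length : Unique C → All (FalseUnder σ) C → ∣ C ∣ ≤ n σ
falsified-length {σ = σ} C-unique C↦0 =
  ℕ.≤-trans (Unique-⊆⇒length-≤ C-unique (FalseUnder⇒∈falsified ∘ All.lookup C↦0))
            (ℕ.≤-reflexive (length-map falsifiedBy σ))

∷-IsPAss : ∀ {v} ε → v ∉ varsP σ → IsPAss σ → IsPAss ((v , ε) ∷ σ)
∷-IsPAss {σ = σ} _ v∉σ σ-pass = All.¬Any⇒All¬ (varsP σ) v∉σ ∷ σ-pass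

module _ (res : ResolventOn C D x R) where

  resolvent-⊆ : y ∈ R → y ∈ C ⊎ y ∈ D
  resolvent-⊆ {y} y∈R = proj₁ (proj₁ (proj₂ (proj₂ (proj₂ res)) y) y∈R)

  resolvent-⊇ˡ : IsClause C → y ∈ C → y ≢ x → y ∈ R
  resolvent-⊇ˡ {y} (_ , no-pair) y∈C y≢x =
    proj₂ (proj₂ (proj₂ (proj₂ res)) y) (inj₁ y∈C) y≢x
      λ { refl → no-pair x (proj₁ res) y∈C }

  resolvent-⊇ʳ : IsClause D → y ∈ D → y ≢ ‾ x → y ∈ R
  resolvent-⊇ʳ {y} (_ , no-pair) y∈D y≢‾x =
    proj₂ (proj₂ (proj₂ (proj₂ res)) y) (inj₂ y∈D)
      (λ { refl → no-pair (‾ x) (proj₁ (proj₂ res))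
                    (subst (_∈ D) (sym (‾-involutive x)) y∈D) })
      y≢‾x

module _ (C D : Clause) (x : Lit) where

  private
    keepˡ? : ∀ y → Dec (y ≢ x)
    keepˡ? y = ¬? (y ≟ˡ x)
    keepʳ? : ∀ y → Dec (y ≢ ‾ x × y ∉ C)
    keepʳ? y = ¬? (y ≟ˡ ‾ x) ×-dec ¬? (y ∈ˡ? C)

  resolve : Clause
  resolve = filter keepˡ? C ++ filter keepʳ? D

  resolve-⊆ : y ∈ resolve → y ∈ C × y ≢ x ⊎ y ∈ D × y ≢ ‾ x × y ∉ C
  resolve-⊆ y∈R with ∈-++⁻ (filter keepˡ? C) y∈R
  ... | inj₁ y∈C′ = inj₁ (∈-filter⁻ keepˡ? y∈C′)
  ... | inj₂ y∈D′ = inj₂ (∈-filter⁻ keepʳ? {xs = D} y∈D′)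

  resolve-Unique : Unique C → Unique D → Unique resolve
  resolve-Unique C-unique D-unique =
    Unique.++⁺ (Unique.filter⁺ keepˡ? C-unique) (Unique.filter⁺ keepʳ? D-unique)
      λ (y∈C′ , y∈D′) → proj₂ (proj₂ (∈-filter⁻ keepʳ? {xs = D} y∈D′))
                           (proj₁ (∈-filter⁻ keepˡ? {xs = C} y∈C′))

  resolve-ResolventOn : IsClause C → x ∈ C → ‾ x ∈ D → (∀ y → y ∈ C → ‾ y ∈ D → y ≡ x) →
                        ResolventOn C D x resolve
  resolve-ResolventOn (_ , no-pair) x∈C ‾x∈D only-clash =
    x∈C , ‾x∈D , only-clash , λ y → sound y , complete y
    where
    ‾x∉C : ‾ x ∉ C
    ‾x∉C = no-pair x x∈C
    sound : ∀ y → y ∈ resolve → (y ∈ C ⊎ y ∈ D) × y ≢ x × y ≢ ‾ x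
    sound y y∈R with resolve-⊆ y∈R
    ... | inj₁ (y∈C , y≢x)        = inj₁ y∈C , y≢x , λ { refl → ‾x∉C y∈C }
    ... | inj₂ (y∈D , y≢‾x , y∉C) = inj₂ y∈D , (λ { refl → y∉C x∈C }) , y≢‾x
    complete : ∀ y → (y ∈ C ⊎ y ∈ D) → y ≢ x → y ≢ ‾ x → y ∈ resolve
    complete y (inj₁ y∈C) y≢x _ = ∈-++⁺ˡ (∈-filter⁺ keepˡ? y∈C y≢x)
    complete y (inj₂ y∈D) y≢x y≢‾x with y ∈ˡ? C
    ... | yes y∈C = ∈-++⁺ˡ (∈-filter⁺ keepˡ? y∈C y≢x)
    ... | no y∉C  = ∈-++⁺ʳ (filter keepˡ? C) (∈-filter⁺ keepʳ? y∈D (y≢‾x , y∉C))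

label-IsClause : ∀ {T} → IsResTree T → IsClause (label T)
label-IsClause (leaf C-clause) = C-clause
label-IsClause (node C-clause _ _ _) = C-clause

label-vars : ∀ {T} → IsResTree T → LeavesIn F T → y ∈ label T → var y ∈var F
label-vars {y = y} (leaf _) (D , D∈F , C≐D) y∈C = D , D∈F , y , proj₁ (C≐D y) y∈C , refl
label-vars (node _ (inj₁ (_ , res)) t₁ t₂) (l₁ , l₂) y∈C =
  Sum.[ label-vars t₁ l₁ , label-vars t₂ l₂ ] (resolvent-⊆ res y∈C)
label-vars (node _ (inj₂ (_ , res)) t₁ t₂) (l₁ , l₂) y∈C =
  Sum.[ label-vars t₂ l₂ , label-vars t₁ l₁ ] (resolvent-⊆ res y∈C)

whd-node-≤ : ∀ {T₁ T₂} → whd (node C T₁ T₂) ≤ k →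
             whd T₁ ≤ k × whd T₂ ≤ k × (∣ label T₁ ∣ ≤ k ⊎ ∣ label T₂ ∣ ≤ k)
whd-node-≤ {k = k} {T₁ = T₁} {T₂} w≤k =
  ℕ.m⊔n≤o⇒m≤o (whd T₁) _ subtrees≤k , ℕ.m⊔n≤o⇒n≤o (whd T₁) _ subtrees≤k , smaller-side
  where
  subtrees≤k = ℕ.m⊔n≤o⇒m≤o (whd T₁ ⊔ whd T₂) _ w≤k
  min≤k = ℕ.m⊔n≤o⇒n≤o (whd T₁ ⊔ whd T₂) _ w≤k
  smaller-side : ∣ label T₁ ∣ ≤ k ⊎ ∣ label T₂ ∣ ≤ k
  smaller-side with ℕ.⊓-sel ∣ label T₁ ∣ ∣ label T₂ ∣
  ... | inj₁ eq = inj₁ (subst (_≤ k) eq min≤k)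
  ... | inj₂ eq = inj₂ (subst (_≤ k) eq min≤k)

module Soundness {ℙ : PAss → Set} (kc : KConsistent k F ℙ) where

  Unfalsified : Clause → Set
  Unfalsified C = ∀ φ → ℙ φ → ¬ All (FalseUnder φ) C

  -- ψ collects the assignments of φ falsifying E − {z}; it is short because
  -- |E| ≤ k, and k-consistency extends it by the assignment falsifying z.
  falsify-short-clause : z ∈ E → ∣ E ∣ ≤ k → var z ∈var F → ℙ φ → var z ∉ varsP φ →
                         (∀ {y} → y ∈ E → y ≢ z → FalseUnder φ y) →
                         ∃ λ φ′ → ℙ φ′ × All (FalseUnder φ′) E
  falsify-short-clause {z} {E} {φ} z∈E |E|≤k z∈F φ∈ℙ z∉φ rest-false =
    let φ′ , φ′∈ℙ , ψ⊆φ′ , z↦0 = proj₂ kc φ φ∈ℙ (var z) z∈F z∉φ ψ (Unique⇒IsPAss ψ-unique ψ⊆φ φ-pass)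
                                   (λ _ → ψ⊆φ) |ψ|<k (not (pos z))
    in φ′ , φ′∈ℙ , All-except (λ y∈E y≢z → ψ⊆φ′ _ (falsifying-in-ψ y∈E y≢z)) z↦0
    where
    falsifies-rest? : ∀ p → Dec (falsifiedBy p ∈ E × falsifiedBy p ≢ z)
    falsifies-rest? p = falsifiedBy p ∈ˡ? E ×-dec ¬? (falsifiedBy p ≟ˡ z)
    ψ = filter falsifies-rest? φ
    φ-pass = proj₁ (proj₂ (proj₁ kc) φ φ∈ℙ)
    ψ⊆φ : ψ ⊆ φ
    ψ⊆φ = proj₁ ∘ ∈-filter⁻ falsifies-rest?
    ψ-unique : Unique ψ
    ψ-unique = Unique.filter⁺ falsifies-rest? (IsPAss⇒Unique φ-pass)
    falsifying-in-ψ : ∀ {y} → y ∈ E → y ≢ z → (var y , not (pos y)) ∈ ψ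
    falsifying-in-ψ {y} y∈E y≢z = ∈-filter⁺ falsifies-rest? (rest-false y∈E y≢z)
      (subst (_∈ E) (sym (falsifiedBy-FalseUnder y)) y∈E ,
       subst (_≢ z) (sym (falsifiedBy-FalseUnder y)) y≢z)
    z∷ψ-unique : Unique (z ∷ map falsifiedBy ψ)
    z∷ψ-unique = All.tabulate z-fresh ∷ Unique.map⁺ falsifiedBy-injective ψ-unique
      where
      z-fresh : ∀ {y} → y ∈ map falsifiedBy ψ → z ≢ y
      z-fresh y∈ refl with p , p∈ψ , refl ← ∈-map⁻ falsifiedBy y∈ =
        proj₂ (proj₂ (∈-filter⁻ falsifies-rest? {xs = φ} p∈ψ)) refl
    z∷ψ⊆E : z ∷ map falsifiedBy ψ ⊆ E
    z∷ψ⊆E (here refl) = z∈E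
    z∷ψ⊆E (there y∈) with p , p∈ψ , refl ← ∈-map⁻ falsifiedBy y∈ =
      proj₁ (proj₂ (∈-filter⁻ falsifies-rest? {xs = φ} p∈ψ))
    |ψ|<k : n ψ < k
    |ψ|<k = ℕ.≤-trans (subst (_≤ ∣ E ∣) (cong suc (length-map falsifiedBy ψ))
                               (Unique-⊆⇒length-≤ z∷ψ-unique z∷ψ⊆E)) |E|≤k

  resolvent-unfalsified : ResolventOn C D x R → IsClause C → IsClause D → var x ∈var F →
                          Unfalsified C → Unfalsified D → ∣ C ∣ ≤ k ⊎ ∣ D ∣ ≤ k →
                          Unfalsified R
  resolvent-unfalsified {C = C} {D} {x} res C-clause D-clause x∈F C-ok D-ok short φ φ∈ℙ R↦0 =
    by-cases (var x ∈ⁿ? varsP φ) short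
    where
    C-rest : ∀ {y} → y ∈ C → y ≢ x → FalseUnder φ y
    C-rest y∈C y≢x = All.lookup R↦0 (resolvent-⊇ˡ res C-clause y∈C y≢x)
    D-rest : ∀ {y} → y ∈ D → y ≢ ‾ x → FalseUnder φ y
    D-rest y∈D y≢‾x = All.lookup R↦0 (resolvent-⊇ʳ res D-clause y∈D y≢‾x)
    by-cases : Dec (var x ∈ varsP φ) → ∣ C ∣ ≤ k ⊎ ∣ D ∣ ≤ k → ⊥
    by-cases (yes x-assigned) _ with assigned⇒FalseUnder x-assigned
    ... | inj₁ x↦0  = C-ok φ φ∈ℙ (All-except C-rest x↦0)
    ... | inj₂ ‾x↦0 = D-ok φ φ∈ℙ (All-except D-rest ‾x↦0)
    by-cases (no x-unassigned) (inj₁ |C|≤k) =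
      let φ′ , φ′∈ℙ , C↦0 = falsify-short-clause (proj₁ res) |C|≤k x∈F φ∈ℙ x-unassigned C-rest
      in C-ok φ′ φ′∈ℙ C↦0
    by-cases (no x-unassigned) (inj₂ |D|≤k) =
      let φ′ , φ′∈ℙ , D↦0 = falsify-short-clause (proj₁ (proj₂ res)) |D|≤k x∈F φ∈ℙ x-unassigned D-rest
      in D-ok φ′ φ′∈ℙ D↦0

  tree-unfalsified : ∀ {T} → IsResTree T → LeavesIn F T → whd T ≤ k → Unfalsified (label T)
  tree-unfalsified (leaf _) (D , D∈F , C≐D) _ φ φ∈ℙ C↦0 =
    proj₂ (proj₂ (proj₂ (proj₁ kc) φ φ∈ℙ))
      (D , D∈F , All.tabulate λ {y} y∈D → All.lookup C↦0 (proj₂ (C≐D y) y∈D))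
  tree-unfalsified {T = node R T₁ T₂} (node _ r t₁ t₂) (l₁ , l₂) w≤k
    with w₁≤k , w₂≤k , short ← whd-node-≤ {C = R} {T₁ = T₁} {T₂} w≤k
    with ok₁ ← tree-unfalsified t₁ l₁ w₁≤k | ok₂ ← tree-unfalsified t₂ l₂ w₂≤k
    with r
  ... | inj₁ (_ , res) = resolvent-unfalsified res (label-IsClause t₁) (label-IsClause t₂)
                           (label-vars t₁ l₁ (proj₁ res)) ok₁ ok₂ short
  ... | inj₂ (_ , res) = resolvent-unfalsified res (label-IsClause t₂) (label-IsClause t₁)
                           (label-vars t₂ l₂ (proj₁ res)) ok₂ ok₁ (Sum.swap short)

  whd-greater : WhdGreater F k
  whd-greater T (t , l , root≡⊥) with φ , φ∈ℙ ← proj₁ (proj₁ kc) = ℕ.≰⇒> λ w≤k →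
    tree-unfalsified t l w≤k φ φ∈ℙ (subst (All (FalseUnder φ)) (sym root≡⊥) [])

module Completeness {F : ClauseSet} (F-clauses : IsClauseSet F) {k : ℕ} (whd>k : WhdGreater F k) where

  Derivable : Clause → Set
  Derivable C = ∃ λ T → IsResTree T × LeavesIn F T × label T ≡ C × whd T ≤ k

  ⊥-underivable : ¬ Derivable []
  ⊥-underivable (T , t , l , root≡⊥ , w≤k) = ℕ.<⇒≱ (whd>k T (t , l , root≡⊥)) w≤k

  Derivable-IsClause : Derivable C → IsClause C
  Derivable-IsClause (_ , t , _ , refl , _) = label-IsClause t

  Derivable-vars : Derivable C → y ∈ C → var y ∈var F
  Derivable-vars (_ , t , l , refl , _) = label-vars t l

  axiom-derivable : C ∈ F → Derivable C
  axiom-derivable {C} C∈F =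
    leaf C , leaf (All.lookup F-clauses C∈F) , (C , C∈F , λ _ → id , id) , refl , z≤n

  resolvent-derivable : Derivable C → Derivable D → ResolventOn C D x R → IsClause R →
                        ∣ C ∣ ≤ k ⊎ ∣ D ∣ ≤ k → Derivable R
  resolvent-derivable {x = x} {R} (T₁ , t₁ , l₁ , refl , w₁) (T₂ , t₂ , l₂ , refl , w₂) res R-clause short =
    node R T₁ T₂ , node R-clause (inj₁ (x , res)) t₁ t₂ , (l₁ , l₂) , refl ,
    ℕ.⊔-lub (ℕ.⊔-lub w₁ w₂) (Sum.[ ℕ.m≤n⇒m⊓o≤n _ , ℕ.m≤n⇒o⊓m≤n _ ] short)

  Forces : PAss → Clause → Lit → Set
  Forces σ D w = Derivable D × ∣ D ∣ ≤ k × w ∈ D × (∀ {y} → y ∈ D → y ≢ w → FalseUnder σ y)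

  Consistent : PAss → Set
  Consistent σ = ∀ {C} → Derivable C → ¬ All (FalseUnder σ) C

  Closed : PAss → Set
  Closed σ = ∀ {D w} → Forces σ D w → var w ∈ varsP σ

  InVarF : PAss → Set
  InVarF σ = ∀ v → v ∈ varsP σ → v ∈var F

  record Stable (σ : PAss) : Set where
    field
      isPAss     : IsPAss σ
      inVarF     : InVarF σ
      consistent : Consistent σ
      closed     : Closed σ

  data _⇝_ (ρ : PAss) : PAss → Set where
    stop : ρ ⇝ ρ
    step : ∀ {σ D w} → ρ ⇝ σ → Forces σ D w → var w ∉ varsP σ → ρ ⇝ ((var w , pos w) ∷ σ)

  ⇝-⊇ : ∀ {ρ} → ρ ⇝ σ → ρ ⊆ σ
  ⇝-⊇ stop = id
  ⇝-⊇ (step r _ _) = there ∘ ⇝-⊇ r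

  ⇝-IsPAss : ∀ {ρ} → IsPAss ρ → ρ ⇝ σ → IsPAss σ
  ⇝-IsPAss ρ-pass stop = ρ-pass
  ⇝-IsPAss ρ-pass (step {w = w} r _ w∉σ) = ∷-IsPAss (pos w) w∉σ (⇝-IsPAss ρ-pass r)

  ∷-InVarF : Forces σ D w → InVarF σ → InVarF ((var w , pos w) ∷ σ)
  ∷-InVarF (D-der , _ , w∈D , _) _ _ (here refl) = Derivable-vars D-der w∈D
  ∷-InVarF _ σ-vars v (there v∈σ) = σ-vars v v∈σ

  ⇝-InVarF : ∀ {ρ} → InVarF ρ → ρ ⇝ σ → InVarF σ
  ⇝-InVarF ρ-vars stop = ρ-vars
  ⇝-InVarF ρ-vars (step r forced _) = ∷-InVarF forced (⇝-InVarF ρ-vars r)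

  -- Resolve with the forcing clause; the width stays ≤ k because that clause is short.
  unpropagate : Forces σ D w → IsPAss σ → Derivable C → All (FalseUnder ((var w , pos w) ∷ σ)) C →
                ∃ λ C′ → Derivable C′ × All (FalseUnder σ) C′
  unpropagate {σ} {D} {w} {C} (D-der , |D|≤k , w∈D , D-rest) σ-pass C-der C↦0 = by-cases (‾ w ∈ˡ? C)
    where
    σ-fun = IsPAss⇒Functional σ-pass
    C-rest : ∀ {y} → y ∈ C → y ≢ ‾ w → FalseUnder σ y
    C-rest y∈C y≢‾w = Sum.[ ⊥-elim ∘ y≢‾w , id ] (FalseUnder-∷⁻ (All.lookup C↦0 y∈C))
    only-clash : ∀ y → y ∈ C → ‾ y ∈ D → y ≡ ‾ w
    only-clash y y∈C ‾y∈D with y ≟ˡ ‾ w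
    ... | yes y≡‾w = y≡‾w
    ... | no y≢‾w  = ⊥-elim (FalseUnder-complement σ-fun (C-rest y∈C y≢‾w)
                       (D-rest ‾y∈D λ ‾y≡w → y≢‾w (trans (sym (‾-involutive y)) (cong ‾_ ‾y≡w))))
    resolvent = resolve C D (‾ w)
    resolvent↦0 : ∀ {y} → y ∈ resolvent → FalseUnder σ y
    resolvent↦0 {y} y∈R with resolve-⊆ C D (‾ w) y∈R
    ... | inj₁ (y∈C , y≢‾w)       = C-rest y∈C y≢‾w
    ... | inj₂ (y∈D , y≢‾‾w , _) = D-rest y∈D λ { refl → y≢‾‾w (sym (‾-involutive y)) }
    resolvent-clause : IsClause resolvent
    resolvent-clause = resolve-Unique C D (‾ w) (proj₁ (Derivable-IsClause C-der)) (proj₁ (Derivable-IsClause D-der)) ,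
               λ y y∈R ‾y∈R → FalseUnder-complement σ-fun (resolvent↦0 y∈R) (resolvent↦0 ‾y∈R)
    by-cases : Dec (‾ w ∈ C) → ∃ λ C′ → Derivable C′ × All (FalseUnder σ) C′
    by-cases (no ‾w∉C)  = C , C-der , All.tabulate λ y∈C → C-rest y∈C λ { refl → ‾w∉C y∈C }
    by-cases (yes ‾w∈C) = resolvent , resolvent-der , All.tabulate resolvent↦0
      where
      ‾‾w∈D = subst (_∈ D) (sym (‾-involutive w)) w∈D
      resolvent-der = resolvent-derivable C-der D-der
                (resolve-ResolventOn C D (‾ w) (Derivable-IsClause C-der) ‾w∈C ‾‾w∈D only-clash)
                resolvent-clause (inj₂ |D|≤k)

  conflict-analysis : ∀ {ρ} → ρ ⇝ σ → IsPAss σ → Derivable C → All (FalseUnder σ) C →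
                      ∃ λ C′ → Derivable C′ × All (FalseUnder ρ) C′
  conflict-analysis stop _ C-der C↦0 = _ , C-der , C↦0
  conflict-analysis (step r forced _) (_ ∷ σ-pass) C-der C↦0 =
    let C′ , C′-der , C′↦0 = unpropagate forced σ-pass C-der C↦0
    in conflict-analysis r σ-pass C′-der C′↦0

  ⇝-Consistent : ∀ {ρ} → IsPAss ρ → Consistent ρ → ρ ⇝ σ → Consistent σ
  ⇝-Consistent ρ-pass ρ-consistent r C-der C↦0 =
    let C′ , C′-der , C′↦0 = conflict-analysis r (⇝-IsPAss ρ-pass r) C-der C↦0
    in ρ-consistent C′-der C′↦0

  Vars : List ℕ
  Vars = deduplicate ℕ._≟_ (concat (map (map var) F))

  ∈var⇒∈Vars : ∀ {v} → v ∈var F → v ∈ Vars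
  ∈var⇒∈Vars (C , C∈F , x , x∈C , refl) =
    ∈-deduplicate⁺ ℕ._≟_ (∈-concat⁺′ (∈-map⁺ var x∈C) (∈-map⁺ (map var) C∈F))

  ∈Vars⇒∈var : ∀ {v} → v ∈ Vars → v ∈var F
  ∈Vars⇒∈var v∈Vars
    with vs , v∈vs , vs∈ ← ∈-concat⁻′ (map (map var) F) (∈-deduplicate⁻ ℕ._≟_ _ v∈Vars)
    with C , C∈F , refl ← ∈-map⁻ (map var) vs∈
    with x , x∈C , refl ← ∈-map⁻ var v∈vs
    = C , C∈F , x , x∈C , refl

  Vars-Unique : Unique Vars
  Vars-Unique = deduplicate-! ℕ._≟_ _

  length-≤-Vars : IsPAss σ → InVarF σ → n σ ≤ length Vars
  length-≤-Vars {σ} σ-pass σ-vars =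
    subst (_≤ length Vars) (length-map proj₁ σ)
      (Unique-⊆⇒length-≤ σ-pass (∈var⇒∈Vars ∘ σ-vars _))

  unforced⇒Closed : (∀ {D w} → Forces σ D w → var w ∉ varsP σ → ⊥) → Closed σ
  unforced⇒Closed {σ} unforced {w = w} forced with var w ∈ⁿ? varsP σ
  ... | yes w∈σ = w∈σ
  ... | no w∉σ  = ⊥-elim (unforced forced w∉σ)

  -- Propagation adds a new variable of F at each step, so m + n σ ≥ |Vars|
  -- bounds the number of steps left.
  closure : ∀ {ρ} m → length Vars ≤ m + n σ → ρ ⇝ σ → IsPAss σ → InVarF σ →
            ¬ ¬ (∃ λ τ → ρ ⇝ τ × Closed τ)
  closure {σ} zero bound r σ-pass σ-vars no-closure =
    no-closure (σ , r , unforced⇒Closed λ {_} {w} forced w∉σ →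
      ℕ.<-irrefl refl (ℕ.≤-trans (length-≤-Vars {(var w , pos w) ∷ σ} (∷-IsPAss (pos w) w∉σ σ-pass)
                                   (∷-InVarF forced σ-vars)) bound))
  closure {σ} (suc m) bound r σ-pass σ-vars no-closure =
    no-closure (σ , r , unforced⇒Closed λ {_} {w} forced w∉σ →
      closure m (subst (length Vars ≤_) (sym (ℕ.+-suc m (n σ))) bound) (step r forced w∉σ)
        (∷-IsPAss (pos w) w∉σ σ-pass) (∷-InVarF forced σ-vars) no-closure)

  stabilise : ∀ {ρ} → IsPAss ρ → InVarF ρ → Consistent ρ → ¬ ¬ (∃ λ σ → ρ ⊆ σ × Stable σ)
  stabilise ρ-pass ρ-vars ρ-consistent no-stable =
    closure (length Vars) (ℕ.m≤m+n _ _) stop ρ-pass ρ-vars λ (σ , r , σ-closed) →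
      no-stable (σ , ⇝-⊇ r , record
        { isPAss     = ⇝-IsPAss ρ-pass r
        ; inVarF     = ⇝-InVarF ρ-vars r
        ; consistent = ⇝-Consistent ρ-pass ρ-consistent r
        ; closed     = σ-closed
        })

  Stable-extension : Stable φ → ∀ {ψ v} → IsPAss ψ → ψ ⊆ φ → n ψ < k → v ∈var F → v ∉ varsP φ →
                     ∀ ε → ¬ ¬ (∃ λ σ → Stable σ × ψ ⊆ σ × (v , ε) ∈ σ)
  Stable-extension {φ} φ-stable {ψ} {v} ψ-pass ψ⊆φ |ψ|<k v∈F v∉φ ε no-extension =
    stabilise (∷-IsPAss ε v∉ψ ψ-pass) ρ-vars ρ-consistent λ (σ , ρ⊆σ , σ-stable) →
      no-extension (σ , σ-stable , ρ⊆σ ∘ there , ρ⊆σ (here refl))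
    where
    open Stable φ-stable
    ρ = (v , ε) ∷ ψ
    v∉ψ : v ∉ varsP ψ
    v∉ψ = v∉φ ∘ Subset.map⁺ proj₁ ψ⊆φ
    ρ-vars : InVarF ρ
    ρ-vars _ (here refl)  = v∈F
    ρ-vars u (there u∈ψ) = inVarF u (Subset.map⁺ proj₁ ψ⊆φ u∈ψ)
    ρ-consistent : Consistent ρ
    ρ-consistent {C} C-der C↦0 = by-cases (falsifiedBy (v , ε) ∈ˡ? C)
      where
      φ-part : ∀ {y} → y ∈ C → y ≢ falsifiedBy (v , ε) → FalseUnder φ y
      φ-part y∈C y≢v̄ = Sum.[ ⊥-elim ∘ y≢v̄ , ψ⊆φ ] (FalseUnder-∷⁻ (All.lookup C↦0 y∈C))
      |C|≤k = ℕ.≤-trans (falsified-length (proj₁ (Derivable-IsClause C-der)) C↦0) |ψ|<k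
      by-cases : Dec (falsifiedBy (v , ε) ∈ C) → ⊥
      by-cases (no v̄∉C)  = consistent C-der (All.tabulate λ y∈C → φ-part y∈C λ { refl → v̄∉C y∈C })
      by-cases (yes v̄∈C) = v∉φ (closed (C-der , |C|≤k , v̄∈C , φ-part))

  Stable-exists : ¬ ¬ (∃ Stable)
  Stable-exists no-stable =
    stabilise [] (λ _ ()) []-consistent λ (σ , _ , σ-stable) → no-stable (σ , σ-stable)
    where
    []-consistent : Consistent []
    []-consistent {[]} C-der _ = ⊥-underivable C-der
    []-consistent {_ ∷ _} _ (() ∷ _)

  Bools : List Bool
  Bools = false ∷ true ∷ []

  ∈Bools : ∀ ε → ε ∈ Bools
  ∈Bools false = here refl
  ∈Bools true  = there (here refl)

  Pairs : List (ℕ × Bool)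
  Pairs = cartesianProduct Vars Bools

  Pairs-Unique : Unique Pairs
  Pairs-Unique = Unique.cartesianProduct⁺ Vars-Unique (((λ ()) ∷ []) ∷ [] ∷ [])

  Universe : List PAss
  Universe = sublists Pairs

  ∈Universe⇒InVarF : φ ∈ Universe → InVarF φ
  ∈Universe⇒InVarF φ∈U v v∈φ with (.v , _) , p∈φ , refl ← ∈-map⁻ proj₁ v∈φ =
    ∈Vars⇒∈var (proj₁ (∈-cartesianProduct⁻ Vars Bools (sublists-⊆ Pairs φ∈U p∈φ)))

  normalise : PAss → PAss
  normalise σ = filter (_∈ᵖ? σ) Pairs

  normalise-∈ : normalise σ ∈ Universe
  normalise-∈ {σ} = filter∈sublists (_∈ᵖ? σ) Pairs

  normalise-⊆ : normalise σ ⊆ σ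
  normalise-⊆ {σ} = proj₂ ∘ ∈-filter⁻ (_∈ᵖ? σ) {xs = Pairs}

  normalise-⊇ : InVarF σ → σ ⊆ normalise σ
  normalise-⊇ {σ} σ-vars {v , ε} p∈σ =
    ∈-filter⁺ (_∈ᵖ? σ) (∈-cartesianProduct⁺ (∈var⇒∈Vars (σ-vars v (∈-map⁺ proj₁ p∈σ))) (∈Bools ε)) p∈σ

  normalise-IsPAss : IsPAss σ → IsPAss (normalise σ)
  normalise-IsPAss {σ} = Unique⇒IsPAss (Unique.filter⁺ (_∈ᵖ? σ) Pairs-Unique) normalise-⊆

  normalise-Stable : Stable σ → Stable (normalise σ)
  normalise-Stable {σ} σ-stable = record
    { isPAss     = normalise-IsPAss isPAss
    ; inVarF     = λ v → inVarF v ∘ Subset.map⁺ proj₁ normalise-⊆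
    ; consistent = λ C-der → consistent C-der ∘ All.map normalise-⊆
    ; closed     = λ (D-der , |D|≤k , w∈D , D-rest) →
        Subset.map⁺ proj₁ (normalise-⊇ inVarF) (closed (D-der , |D|≤k , w∈D , λ y∈D y≢w → normalise-⊆ (D-rest y∈D y≢w)))
    }
    where open Stable σ-stable

  -- k-consistency of φ relative to S; ψ ranges over Universe, which holds a
  -- normal form of every ψ ⊆ φ.
  Extensible : List PAss → PAss → Set
  Extensible S φ =
    All (λ ψ → IsPAss ψ → All (_∈ φ) ψ → n ψ < k →
               All (λ v → v ∉ varsP φ →
                          All (λ ε → Any (λ φ′ → All (_∈ φ′) ψ × (v , ε) ∈ φ′) S) Bools)
                   Vars)
        Universe

  Extensible? : ∀ S φ → Dec (Extensible S φ)
  Extensible? S φ =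
    All.all? (λ ψ → unique? (varsP ψ) →-dec All.all? (_∈ᵖ? φ) ψ →-dec n ψ ℕ.<? k →-dec
               All.all? (λ v → ¬? (v ∈ⁿ? varsP φ) →-dec
                               All.all? (λ ε → Any.any? (λ φ′ → All.all? (_∈ᵖ? φ′) ψ ×-dec (v , ε) ∈ᵖ? φ′) S) Bools)
                   Vars)
        Universe

  StableIn : PAss → Set
  StableIn φ = Stable φ × φ ∈ Universe

  StableIn⇒Extensible : ∀ {S} → (∀ {u} → StableIn u → u ∈ S) → ∀ {φ} → StableIn φ → Extensible S φ
  StableIn⇒Extensible {S} S⊇Stable {φ} (φ-stable , _) =
    All.tabulate λ {ψ} _ ψ-pass ψ⊆φ |ψ|<k → All.tabulate λ {v} v∈Vars v∉φ → All.tabulate λ {ε} _ →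
      decidable-stable (Any.any? (λ φ′ → All.all? (_∈ᵖ? φ′) ψ ×-dec (v , ε) ∈ᵖ? φ′) S)
        λ no-witness → Stable-extension φ-stable ψ-pass (All.lookup ψ⊆φ) |ψ|<k (∈Vars⇒∈var v∈Vars) v∉φ ε
          λ (σ , σ-stable , ψ⊆σ , v↦ε) →
            let σ⊆normal = normalise-⊇ (Stable.inVarF σ-stable)
            in no-witness (lose (S⊇Stable (normalise-Stable σ-stable , normalise-∈))
                                (All.tabulate (σ⊆normal ∘ ψ⊆σ) , σ⊆normal v↦ε))

  Admissible : PAss → Set
  Admissible φ = IsPAss φ × ¬ Any (All (FalseUnder φ)) F

  Admissible? : ∀ φ → Dec (Admissible φ)
  Admissible? φ = unique? (varsP φ) ×-dec ¬? (Any.any? (All.all? λ y → (var y , not (pos y)) ∈ᵖ? φ) F)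

  Candidates : List PAss
  Candidates = filter Admissible? Universe

  StableIn⇒Candidate : StableIn φ → φ ∈ Candidates
  StableIn⇒Candidate (φ-stable , φ∈U) = ∈-filter⁺ Admissible? φ∈U (isPAss , λ F-falsified →
    let C , C∈F , C↦0 = find F-falsified in consistent (axiom-derivable C∈F) C↦0)
    where open Stable φ-stable

  k-consistent-family : ∃ λ ℙ → KConsistent k F ℙ
  k-consistent-family
    with G , G⊆Candidates , G-extensible , G⊇Stable
           ← prune Extensible? StableIn⇒Extensible (length Candidates) Candidates ℕ.≤-refl StableIn⇒Candidate
    = (_∈ G) , (nonempty , minimal) , extension
    where
    nonempty : ∃ λ φ → φ ∈ G
    nonempty = List-inhabited G λ G-empty → Stable-exists λ (σ , σ-stable) →
      G-empty (normalise σ , G⊇Stable (normalise-Stable σ-stable , normalise-∈))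

    minimal : ∀ φ → φ ∈ G → IsPAss φ × InVarF φ × ¬ (⊥∈ φ * F)
    minimal φ φ∈G with φ∈U , φ-pass , F-unfalsified ← ∈-filter⁻ Admissible? (G⊆Candidates φ∈G) =
      φ-pass , ∈Universe⇒InVarF φ∈U , λ (C , C∈F , C↦0) → F-unfalsified (lose C∈F C↦0)

    extension : ∀ φ → φ ∈ G → ∀ v → v ∈var F → v ∉ varsP φ →
                ∀ ψ → IsPAss ψ → ψ ⊆ₚ φ → n ψ < k → ∀ ε →
                ∃ λ φ′ → φ′ ∈ G × ψ ⊆ₚ φ′ × (v , ε) ∈ φ′
    extension φ φ∈G v v∈F v∉φ ψ ψ-pass ψ⊆φ |ψ|<k ε =
      let φ′ , φ′∈G , ψ′⊆φ′ , v↦ε = find (All.lookup (All.lookup (All.lookup φ-extensible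
                                      normalise-∈ ψ′-pass ψ′⊆φ |ψ′|<k) (∈var⇒∈Vars v∈F) v∉φ) (∈Bools ε))
      in φ′ , φ′∈G , (λ _ p∈ψ → All.lookup ψ′⊆φ′ (normalise-⊇ ψ-vars p∈ψ)) , v↦ε
      where
      φ-extensible = All.lookup G-extensible φ∈G
      ψ′-pass = normalise-IsPAss ψ-pass
      ψ′⊆φ = All.tabulate (ψ⊆φ _ ∘ normalise-⊆)
      |ψ′|<k = ℕ.≤-<-trans (Unique-⊆⇒length-≤ (IsPAss⇒Unique ψ′-pass) normalise-⊆) |ψ|<k
      ψ-vars : InVarF ψ
      ψ-vars u = proj₁ (proj₂ (minimal φ φ∈G)) u ∘ Subset.map⁺ proj₁ (ψ⊆φ _)

theorem5p10 : ∀ (F : ClauseSet) → IsClauseSet F → Unsatisfiable F → ∀ (k : ℕ) →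
    (WhdGreater F k → ∃ λ (ℙ : PAss → Set) → KConsistent k F ℙ) ×
    ((∃ λ (ℙ : PAss → Set) → KConsistent k F ℙ) → WhdGreater F k)
theorem5p10 F F-clauses _ k =
  (λ whd>k → Completeness.k-consistent-family F-clauses whd>k) ,
  (λ (_ , kc) → Soundness.whd-greater kc)
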